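{- Let $T$ be a tree with $n=n(T)\geq 3$ vertices and ${\rm diam}(T)\leq\frac{1+\sqrt{4n-3}}{2}$. Then $E_2(T)\leq W(T)$, with equality if and only if $T\cong P_3$.
   Context: $\varepsilon_T(v)=\max_u d_T(v,u)$ is the eccentricity, ${\rm diam}(T)=\max_v\varepsilon_T(v)$, $E_2(T)=\sum_{uv\in E(T)}\varepsilon_T(u)\varepsilon_T(v)$, $W(T)=\sum_{\{u,v\}\subseteq V(T)}d_T(u,v)$ is the Wiener index, and $P_3$ is the path on $3$ vertices. -}

module Defs where

open import Data.Nat using (ℕ; zero; suc; _+_; _*_; _⊔_; _<ᵇ_)
open import Data.Bool using (Bool; true; false; _∧_; _∨_; not; if_then_else_)
open import Data.Fin using (Fin; zero; suc; toℕ; inject₁; fromℕ; _≟_)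
open import Data.Product using (Σ; _×_; _,_)
open import Relation.Nullary using (¬_)
open import Relation.Nullary.Decidable using (⌊_⌋)
open import Relation.Binary.PropositionalEquality using (_≡_; _≢_)
open import Function.Bundles using (Bijection; _⤖_)
open import Function.Definitions using (Injective)

ΣFin : (n : ℕ) → (Fin n → ℕ) → ℕ
ΣFin zero    f = 0
ΣFin (suc n) f = f zero + ΣFin n (λ i → f (suc i))

MaxFin : (n : ℕ) → (Fin n → ℕ) → ℕ
MaxFin zero    f = 0
MaxFin (suc n) f = f zero ⊔ MaxFin n (λ i → f (suc i))

AnyFin : (n : ℕ) → (Fin n → Bool) → Bool
AnyFin zero    p = false
AnyFin (suc n) p = p zero ∨ AnyFin n (λ i → p (suc i))

record Graph (n : ℕ) : Set where
  field
    adj   : Fin n → Fin n → Bool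
    sym   : ∀ u v → adj u v ≡ adj v u
    irrefl : ∀ u → adj u u ≡ false
open Graph public

module _ {n : ℕ} (G : Graph n) where

  -- reach k u v = true  iff there is a walk of length at most k from u to v.
  reach : ℕ → Fin n → Fin n → Bool
  reach zero    u v = ⌊ u ≟ v ⌋
  reach (suc k) u v = reach k u v ∨ AnyFin n (λ w → reach k u w ∧ adj G w v)

  Connected : Set
  Connected = ∀ u v → Σ ℕ (λ k → reach k u v ≡ true)

  -- A cycle of length m+3: injective closed walk c 0 ~ c 1 ~ ... ~ c (m+2) ~ c 0.
  record Cycle : Set where
    field
      m      : ℕ
      c      : Fin (suc (suc (suc m))) → Fin n
      inj    : Injective _≡_ _≡_ c
      step   : ∀ (i : Fin (suc (suc m))) → adj G (c (inject₁ i)) (c (suc i)) ≡ true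
      close  : adj G (c (fromℕ (suc (suc m)))) (c zero) ≡ true

  IsTree : Set
  IsTree = Connected × ¬ Cycle

  -- Since reach is monotone in k, for a connected graph on n vertices this is
  -- exactly the length of a shortest u–v path (which is < n).
  dist : Fin n → Fin n → ℕ
  dist u v = ΣFin n (λ k → if reach (toℕ k) u v then 0 else 1)

  ecc : Fin n → ℕ
  ecc u = MaxFin n (λ v → dist u v)

  diam : ℕ
  diam = MaxFin n ecc

  ΣPairs : (Fin n → Fin n → ℕ) → ℕ
  ΣPairs f = ΣFin n (λ u → ΣFin n (λ v → if toℕ u <ᵇ toℕ v then f u v else 0))

  E₂ : ℕ
  E₂ = ΣPairs (λ u v → if adj G u v then ecc u * ecc v else 0)

  W : ℕ
  W = ΣPairs dist

_≅_ : {n m : ℕ} → Graph n → Graph m → Set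
_≅_ {n} {m} G H = Σ (Fin n ⤖ Fin m) λ f →
  ∀ u v → adj G u v ≡ adj H (Bijection.to f u) (Bijection.to f v)

P3adj : Fin 3 → Fin 3 → Bool
P3adj zero (suc zero) = true
P3adj (suc zero) zero = true
P3adj (suc zero) (suc (suc zero)) = true
P3adj (suc (suc zero)) (suc zero) = true
P3adj _ _ = false

P₃ : Graph 3
P₃ = record { adj = P3adj ; sym = s ; irrefl = i }
  where
  s : ∀ u v → P3adj u v ≡ P3adj v u
  s zero zero = _≡_.refl
  s zero (suc zero) = _≡_.refl
  s zero (suc (suc zero)) = _≡_.refl
  s (suc zero) zero = _≡_.refl
  s (suc zero) (suc zero) = _≡_.refl
  s (suc zero) (suc (suc zero)) = _≡_.refl
  s (suc (suc zero)) zero = _≡_.refl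
  s (suc (suc zero)) (suc zero) = _≡_.refl
  s (suc (suc zero)) (suc (suc zero)) = _≡_.refl
  i : ∀ u → P3adj u u ≡ false
  i zero = _≡_.refl
  i (suc zero) = _≡_.refl
  i (suc (suc zero)) = _≡_.refl

{-# OPTIONS --safe #-}
-- Let d be the diameter and m the number of edges. Rooting the tree at a vertex farthest from u
-- shows that a vertex u of eccentricity d is a leaf; two adjacent such leaves would make up the
-- whole tree, so ε(u) ε(v) ≤ d (d − 1) on every edge and E₂ ≤ d (d − 1) m. The diameter hypothesis
-- says exactly d (d − 1) ≤ n − 1, and m ≤ n − 1. Counting distance 1 for adjacent and 2 for the
-- other pairs gives W ≥ n (n − 1) − m ≥ (n − 1) m. Equality forces all distances to be at most 2
-- and d (d − 1) = n − 1, hence n = 3 and T has two edges, i.e. T ≅ P₃.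
module Submission where

open import Defs hiding (sym; irrefl)
open import Data.Nat using (ℕ; zero; suc; _+_; _*_; _∸_; _^_; _≤_; _<_; _⊔_; _<ᵇ_; z≤n; s≤s; >-nonZero;
                            _≤′_; ≤′-refl; ≤′-step)
open import Data.Nat.Properties
open import Data.Nat.Tactic.RingSolver using (solve-∀)
open import Data.Bool using (Bool; true; false; _∧_; _∨_; if_then_else_; T)
open import Data.Bool.Properties using () renaming (_≟_ to _≟ᵇ_)
open import Data.Unit using (tt)
open import Data.Fin using (Fin; zero; suc; toℕ; inject₁; fromℕ; fromℕ<) renaming (_≟_ to _≟ᶠ_)
import Data.Fin.Properties as Fin
open import Data.Fin.Patterns using (0F; 1F; 2F)
open import Data.Fin.Permutation as Perm using (Permutation′; _⟨$⟩ʳ_; transpose)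
open import Data.Product using (_×_; _,_; proj₁; proj₂; ∃)
open import Data.Sum using (_⊎_; inj₁; inj₂; [_,_])
open import Data.Empty using (⊥; ⊥-elim)
open import Data.List using (List; []; _∷_; _++_; length; lookup)
open import Data.List.Membership.Propositional using (_∉_)
open import Data.List.Membership.Propositional.Properties using (∈-++⁻; ∈-lookup)
open import Data.List.Relation.Unary.Any using (here; there)
open import Data.List.Relation.Unary.All as All using (All; []; _∷_)
open import Data.List.Relation.Unary.All.Properties using (∷ʳ⁺; ¬Any⇒All¬)
open import Data.List.Relation.Unary.Linked using (Linked; []; [-]; _∷_)
open import Data.List.Relation.Unary.Unique.Propositional using (Unique; []; _∷_)
import Data.List.Relation.Unary.Unique.Propositional.Properties as Unique
open import Relation.Nullary using (¬_; yes; no)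
open import Relation.Nullary.Decidable using (⌊_⌋; True; toWitness)
open import Relation.Binary.PropositionalEquality hiding ([_])
open import Relation.Binary.Definitions using (tri<; tri≈; tri>)
open import Function using (_∘_; case_of_)
open import Function.Bundles using (_⇔_; mk⇔; Bijection)
open import Function.Properties.Inverse using (↔⇒⤖)

∨-true⁻ : ∀ a {b} → a ∨ b ≡ true → a ≡ true ⊎ b ≡ true
∨-true⁻ true  e = inj₁ refl
∨-true⁻ false e = inj₂ e

∨-trueˡ : ∀ {a} b → a ≡ true → a ∨ b ≡ true
∨-trueˡ b refl = refl

∨-trueʳ : ∀ a {b} → b ≡ true → a ∨ b ≡ true
∨-trueʳ true  e = refl
∨-trueʳ false e = e

∧-true⁻ : ∀ a {b} → a ∧ b ≡ true → a ≡ true × b ≡ true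
∧-true⁻ true {true} e = refl , refl

∧-true⁺ : ∀ {a b} → a ≡ true → b ≡ true → a ∧ b ≡ true
∧-true⁺ refl refl = refl

true≢false : ∀ {b} → b ≡ true → b ≡ false → ⊥
true≢false refl ()

ind : Bool → ℕ
ind b = if b then 1 else 0

ind-injective : ∀ {a b} → ind a ≡ ind b → a ≡ b
ind-injective {true}  {true}  _ = refl
ind-injective {false} {false} _ = refl

ind≤1 : ∀ b → ind b ≤ 1
ind≤1 true  = s≤s z≤n
ind≤1 false = z≤n

AnyFin-true⁻ : ∀ n (p : Fin n → Bool) → AnyFin n p ≡ true → ∃ λ i → p i ≡ true
AnyFin-true⁻ (suc n) p e with ∨-true⁻ (p zero) e
... | inj₁ p0 = zero , p0
... | inj₂ ps with AnyFin-true⁻ n (λ i → p (suc i)) ps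
...   | i , pi = suc i , pi

AnyFin-true⁺ : ∀ n (p : Fin n → Bool) i → p i ≡ true → AnyFin n p ≡ true
AnyFin-true⁺ (suc n) p zero    e = ∨-trueˡ _ e
AnyFin-true⁺ (suc n) p (suc i) e = ∨-trueʳ (p zero) (AnyFin-true⁺ n (λ j → p (suc j)) i e)

AnyFin-cong : ∀ n {p q : Fin n → Bool} → (∀ i → p i ≡ q i) → AnyFin n p ≡ AnyFin n q
AnyFin-cong zero    e = refl
AnyFin-cong (suc n) e = cong₂ _∨_ (e zero) (AnyFin-cong n (λ i → e (suc i)))

ΣFin-cong : ∀ n {f g : Fin n → ℕ} → (∀ i → f i ≡ g i) → ΣFin n f ≡ ΣFin n g
ΣFin-cong zero    e = refl
ΣFin-cong (suc n) e = cong₂ _+_ (e zero) (ΣFin-cong n (λ i → e (suc i)))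

ΣFin-mono : ∀ n {f g : Fin n → ℕ} → (∀ i → f i ≤ g i) → ΣFin n f ≤ ΣFin n g
ΣFin-mono zero    le = z≤n
ΣFin-mono (suc n) le = +-mono-≤ (le zero) (ΣFin-mono n (λ i → le (suc i)))

ΣFin-const : ∀ n c → ΣFin n (λ _ → c) ≡ n * c
ΣFin-const zero    c = refl
ΣFin-const (suc n) c = cong (c +_) (ΣFin-const n c)

ΣFin-zero : ∀ n {f : Fin n → ℕ} → (∀ i → f i ≡ 0) → ΣFin n f ≡ 0
ΣFin-zero zero    f≡0 = refl
ΣFin-zero (suc n) f≡0 = cong₂ _+_ (f≡0 zero) (ΣFin-zero n (λ i → f≡0 (suc i)))

ΣFin-distrib-+ : ∀ n (f g : Fin n → ℕ) → ΣFin n (λ i → f i + g i) ≡ ΣFin n f + ΣFin n g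
ΣFin-distrib-+ zero    f g = refl
ΣFin-distrib-+ (suc n) f g = begin
  f zero + g zero + ΣFin n (λ i → f (suc i) + g (suc i))
    ≡⟨ cong (f zero + g zero +_) (ΣFin-distrib-+ n (λ i → f (suc i)) (λ i → g (suc i))) ⟩
  f zero + g zero + (ΣFin n (λ i → f (suc i)) + ΣFin n (λ i → g (suc i)))
    ≡⟨ interchange (f zero) (g zero) _ _ ⟩
  f zero + ΣFin n (λ i → f (suc i)) + (g zero + ΣFin n (λ i → g (suc i))) ∎
  where
  open ≡-Reasoning
  interchange : ∀ a b c d → a + b + (c + d) ≡ a + c + (b + d)
  interchange = solve-∀

ΣFin-distribˡ-* : ∀ n c (f : Fin n → ℕ) → ΣFin n (λ i → c * f i) ≡ c * ΣFin n f
ΣFin-distribˡ-* zero    c f = sym (*-zeroʳ c)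
ΣFin-distribˡ-* (suc n) c f =
  trans (cong (c * f zero +_) (ΣFin-distribˡ-* n c (λ i → f (suc i))))
        (sym (*-distribˡ-+ c (f zero) _))

ΣFin-swap : ∀ n m (f : Fin n → Fin m → ℕ) →
  ΣFin n (λ u → ΣFin m (f u)) ≡ ΣFin m (λ v → ΣFin n (λ u → f u v))
ΣFin-swap zero    m f = sym (ΣFin-zero m (λ _ → refl))
ΣFin-swap (suc n) m f = begin
  ΣFin m (f zero) + ΣFin n (λ u → ΣFin m (f (suc u)))
    ≡⟨ cong (ΣFin m (f zero) +_) (ΣFin-swap n m (λ u → f (suc u))) ⟩
  ΣFin m (f zero) + ΣFin m (λ v → ΣFin n (λ u → f (suc u) v))
    ≡⟨ sym (ΣFin-distrib-+ m (f zero) _) ⟩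
  ΣFin m (λ v → f zero v + ΣFin n (λ u → f (suc u) v)) ∎
  where open ≡-Reasoning

term≤ΣFin : ∀ n (f : Fin n → ℕ) i → f i ≤ ΣFin n f
term≤ΣFin (suc n) f zero    = m≤m+n _ _
term≤ΣFin (suc n) f (suc i) = ≤-trans (term≤ΣFin n (λ j → f (suc j)) i) (m≤n+m _ (f zero))

ΣFin-mono-≡⇒≡ : ∀ n {f g : Fin n → ℕ} → (∀ i → f i ≤ g i) → ΣFin n f ≡ ΣFin n g →
  ∀ i → f i ≡ g i
ΣFin-mono-≡⇒≡ (suc n) {f} {g} le eq i with m≤n⇒m<n∨m≡n (le zero)
... | inj₁ f0<g0 = ⊥-elim (<⇒≢ (+-mono-<-≤ f0<g0 (ΣFin-mono n (λ k → le (suc k)))) eq)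
... | inj₂ f0≡g0 with i
...   | zero  = f0≡g0
...   | suc j = ΣFin-mono-≡⇒≡ n (λ k → le (suc k))
                  (+-cancelˡ-≡ (f zero) _ _ (trans eq (cong (_+ _) (sym f0≡g0)))) j

ΣFin-≤1 : ∀ n (f : Fin n → ℕ) → (∀ i → f i ≤ 1) →
  (∀ i j → 1 ≤ f i → 1 ≤ f j → i ≡ j) → ΣFin n f ≤ 1
ΣFin-≤1 zero    f ≤1 uniq = z≤n
ΣFin-≤1 (suc n) f ≤1 uniq with m≤n⇒m<n∨m≡n (≤1 zero)
... | inj₁ (s≤s f0≤0) = +-mono-≤ f0≤0 (ΣFin-≤1 n _ (λ i → ≤1 (suc i))
                          (λ i j p q → Fin.suc-injective (uniq (suc i) (suc j) p q)))
... | inj₂ f0≡1 = +-mono-≤ (≤1 zero) (≤-reflexive (ΣFin-zero n rest≡0))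
  where
  rest≡0 : ∀ i → f (suc i) ≡ 0
  rest≡0 i = n≤0⇒n≡0 (≮⇒≥ λ 1≤fi → 0≢suc (uniq zero (suc i) (≤-reflexive (sym f0≡1)) 1≤fi))
    where
    0≢suc : zero ≢ suc i
    0≢suc ()

ΣFin<n : ∀ n (f : Fin n → ℕ) → (∀ i → f i ≤ 1) → ∀ r → f r ≡ 0 → ΣFin n f < n
ΣFin<n (suc n) f ≤1 zero fr≡0 rewrite fr≡0 = s≤s (begin
  ΣFin n (λ i → f (suc i)) ≤⟨ ΣFin-mono n (λ i → ≤1 (suc i)) ⟩
  ΣFin n (λ _ → 1)         ≡⟨ ΣFin-const n 1 ⟩
  n * 1                    ≡⟨ *-identityʳ n ⟩
  n                        ∎)
  where open ≤-Reasoning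
ΣFin<n (suc n) f ≤1 (suc r) fr≡0 =
  ≤-trans (≤-reflexive (sym (+-suc (f zero) _)))
          (+-mono-≤ (≤1 zero) (ΣFin<n n _ (λ i → ≤1 (suc i)) r fr≡0))

MaxFin-≥ : ∀ n (f : Fin n → ℕ) i → f i ≤ MaxFin n f
MaxFin-≥ (suc n) f zero    = m≤m⊔n _ _
MaxFin-≥ (suc n) f (suc i) = ≤-trans (MaxFin-≥ n _ i) (m≤n⊔m (f zero) _)

MaxFin-lub : ∀ n {f : Fin n → ℕ} {c} → (∀ i → f i ≤ c) → MaxFin n f ≤ c
MaxFin-lub zero    f≤c = z≤n
MaxFin-lub (suc n) f≤c = ⊔-lub (f≤c zero) (MaxFin-lub n (λ i → f≤c (suc i)))

MaxFin-attained : ∀ n (f : Fin n → ℕ) → Fin n → ∃ λ i → MaxFin n f ≡ f i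
MaxFin-attained (suc n) f _ = attained n f
  where
  attained : ∀ n (f : Fin (suc n) → ℕ) → ∃ λ i → MaxFin (suc n) f ≡ f i
  attained zero    f = zero , ⊔-identityʳ (f zero)
  attained (suc n) f with ⊔-sel (f zero) (MaxFin (suc n) (λ i → f (suc i)))
  ... | inj₁ max≡f0 = zero , max≡f0
  ... | inj₂ max≡rest with attained n (λ i → f (suc i))
  ...   | i , rest≡fi = suc i , trans max≡rest rest≡fi

MaxFin-cong : ∀ n {f g : Fin n → ℕ} → (∀ i → f i ≡ g i) → MaxFin n f ≡ MaxFin n g
MaxFin-cong zero    e = refl
MaxFin-cong (suc n) e = cong₂ _⊔_ (e zero) (MaxFin-cong n (λ i → e (suc i)))

<ᵇ-true⇒< : ∀ a b → (a <ᵇ b) ≡ true → a < b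
<ᵇ-true⇒< a b a<ᵇb = <ᵇ⇒< a b (subst T (sym a<ᵇb) tt)

if-<ᵇ-mono : ∀ a b {x y} → (a < b → x ≤ y) → (if a <ᵇ b then x else 0) ≤ (if a <ᵇ b then y else 0)
if-<ᵇ-mono a b x≤y with a <ᵇ b in a<ᵇb
... | true  = x≤y (<ᵇ-true⇒< a b a<ᵇb)
... | false = z≤n

if-<ᵇ-true : ∀ a b {x} → a < b → (if a <ᵇ b then x else 0) ≡ x
if-<ᵇ-true a b a<b with a <ᵇ b | <⇒<ᵇ a<b
... | true | _ = refl

if-<ᵇ-exclusive : ∀ a b x → (if a <ᵇ b then x else 0) + (if b <ᵇ a then x else 0) ≤ x
if-<ᵇ-exclusive a b x with a <ᵇ b in a<ᵇb | b <ᵇ a in b<ᵇa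
... | true  | true  = ⊥-elim (<-asym (<ᵇ-true⇒< a b a<ᵇb) (<ᵇ-true⇒< b a b<ᵇa))
... | true  | false = ≤-reflexive (+-identityʳ x)
... | false | true  = ≤-refl
... | false | false = z≤n

if-distrib-+ : ∀ (b : Bool) x y → (if b then x + y else 0) ≡ (if b then x else 0) + (if b then y else 0)
if-distrib-+ true  x y = refl
if-distrib-+ false x y = refl

if-distribˡ-* : ∀ (b : Bool) c x → (if b then c * x else 0) ≡ c * (if b then x else 0)
if-distribˡ-* true  c x = refl
if-distribˡ-* false c x = sym (*-zeroʳ c)

countAbove : ∀ m k → ΣFin m (λ v → if k <ᵇ toℕ v then 1 else 0) ≡ m ∸ suc k
countAbove zero    k       = refl
countAbove (suc m) zero    = trans (ΣFin-const m 1) (*-identityʳ m)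
countAbove (suc m) (suc k) = countAbove m k

twice-Σ-countAbove : ∀ m → 2 * ΣFin m (λ u → m ∸ suc (toℕ u)) ≡ m * (m ∸ 1)
twice-Σ-countAbove zero    = refl
twice-Σ-countAbove (suc m) = begin
  2 * (m + S)         ≡⟨ *-distribˡ-+ 2 m S ⟩
  2 * m + 2 * S       ≡⟨ cong (2 * m +_) (twice-Σ-countAbove m) ⟩
  2 * m + m * (m ∸ 1) ≡⟨ step m ⟩
  suc m * m           ∎
  where
  open ≡-Reasoning
  S = ΣFin m (λ u → m ∸ suc (toℕ u))
  step : ∀ m → 2 * m + m * (m ∸ 1) ≡ suc m * m
  step zero    = refl
  step (suc k) = identity k
    where
    identity : ∀ k → 2 * suc k + suc k * k ≡ suc (suc k) * suc k
    identity = solve-∀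

module _ {n : ℕ} (G : Graph n) where

  ΣPairs-mono : ∀ {f g : Fin n → Fin n → ℕ} → (∀ u v → toℕ u < toℕ v → f u v ≤ g u v) →
    ΣPairs G f ≤ ΣPairs G g
  ΣPairs-mono f≤g = ΣFin-mono n λ u → ΣFin-mono n λ v → if-<ᵇ-mono (toℕ u) (toℕ v) (f≤g u v)

  ΣPairs-cong : ∀ {f g : Fin n → Fin n → ℕ} → (∀ u v → f u v ≡ g u v) → ΣPairs G f ≡ ΣPairs G g
  ΣPairs-cong f≡g =
    ΣFin-cong n λ u → ΣFin-cong n λ v → cong (if toℕ u <ᵇ toℕ v then_else 0) (f≡g u v)

  ΣPairs-distrib-+ : ∀ (f g : Fin n → Fin n → ℕ) →
    ΣPairs G (λ u v → f u v + g u v) ≡ ΣPairs G f + ΣPairs G g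
  ΣPairs-distrib-+ f g = trans
    (ΣFin-cong n λ u → trans (ΣFin-cong n λ v → if-distrib-+ (toℕ u <ᵇ toℕ v) (f u v) (g u v))
                             (ΣFin-distrib-+ n _ _))
    (ΣFin-distrib-+ n _ _)

  ΣPairs-distribˡ-* : ∀ c (f : Fin n → Fin n → ℕ) → ΣPairs G (λ u v → c * f u v) ≡ c * ΣPairs G f
  ΣPairs-distribˡ-* c f = trans
    (ΣFin-cong n λ u → trans (ΣFin-cong n λ v → if-distribˡ-* (toℕ u <ᵇ toℕ v) c (f u v))
                             (ΣFin-distribˡ-* n c _))
    (ΣFin-distribˡ-* n c _)

  ΣPairs-mono-≡⇒≡ : ∀ {f g : Fin n → Fin n → ℕ} → (∀ u v → toℕ u < toℕ v → f u v ≤ g u v) →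
    ΣPairs G f ≡ ΣPairs G g → ∀ u v → toℕ u < toℕ v → f u v ≡ g u v
  ΣPairs-mono-≡⇒≡ {f} {g} f≤g eq u v u<v = begin
    f u v                                  ≡⟨ sym (if-<ᵇ-true (toℕ u) (toℕ v) u<v) ⟩
    (if toℕ u <ᵇ toℕ v then f u v else 0)  ≡⟨ ΣFin-mono-≡⇒≡ n (λ v → guarded u v) rows-≡ v ⟩
    (if toℕ u <ᵇ toℕ v then g u v else 0)  ≡⟨ if-<ᵇ-true (toℕ u) (toℕ v) u<v ⟩
    g u v                                  ∎
    where
    open ≡-Reasoning
    guarded : ∀ u v → (if toℕ u <ᵇ toℕ v then f u v else 0) ≤ (if toℕ u <ᵇ toℕ v then g u v else 0)
    guarded u v = if-<ᵇ-mono (toℕ u) (toℕ v) (f≤g u v)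
    rows-≡ = ΣFin-mono-≡⇒≡ n (λ u → ΣFin-mono n (guarded u)) eq u

  ΣPairs-complementary : ∀ (f g : Fin n → Fin n → ℕ) → (∀ u v → f u v + g u v ≡ 2) →
    ΣPairs G f + ΣPairs G g ≡ n * (n ∸ 1)
  ΣPairs-complementary f g f+g≡2 = begin
    ΣPairs G f + ΣPairs G g               ≡⟨ sym (ΣPairs-distrib-+ f g) ⟩
    ΣPairs G (λ u v → f u v + g u v)      ≡⟨ ΣPairs-cong f+g≡2 ⟩
    ΣPairs G (λ _ _ → 2)                  ≡⟨ ΣPairs-distribˡ-* 2 (λ _ _ → 1) ⟩
    2 * ΣPairs G (λ _ _ → 1)              ≡⟨ cong (2 *_) (ΣFin-cong n (λ u → countAbove n (toℕ u))) ⟩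
    2 * ΣFin n (λ u → n ∸ suc (toℕ u))    ≡⟨ twice-Σ-countAbove n ⟩
    n * (n ∸ 1)                           ∎
    where open ≡-Reasoning

  ΣPairs-≤-oriented : ∀ {f : Fin n → Fin n → ℕ} (h : Fin n → Fin n → ℕ) →
    (∀ u v → f u v ≤ h u v + h v u) → ΣPairs G f ≤ ΣFin n (λ u → ΣFin n (h u))
  ΣPairs-≤-oriented {f} h f≤h+h = begin
    ΣPairs G f
      ≤⟨ ΣPairs-mono (λ u v _ → f≤h+h u v) ⟩
    ΣPairs G (λ u v → h u v + h v u)
      ≡⟨ ΣPairs-distrib-+ h (λ u v → h v u) ⟩
    forward + ΣFin n (λ u → ΣFin n (λ v → guard u v (h v u)))
      ≡⟨ cong (forward +_) (ΣFin-swap n n (λ u v → guard u v (h v u))) ⟩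
    forward + ΣFin n (λ u → ΣFin n (λ v → guard v u (h u v)))
      ≡⟨ sym (ΣFin-distrib-+ n _ _) ⟩
    ΣFin n (λ u → ΣFin n (λ v → guard u v (h u v)) + ΣFin n (λ v → guard v u (h u v)))
      ≡⟨ ΣFin-cong n (λ u → sym (ΣFin-distrib-+ n _ _)) ⟩
    ΣFin n (λ u → ΣFin n (λ v → guard u v (h u v) + guard v u (h u v)))
      ≤⟨ ΣFin-mono n (λ u → ΣFin-mono n (λ v → if-<ᵇ-exclusive (toℕ u) (toℕ v) (h u v))) ⟩
    ΣFin n (λ u → ΣFin n (h u)) ∎
    where
    open ≤-Reasoning
    guard : Fin n → Fin n → ℕ → ℕ
    guard u v x = if toℕ u <ᵇ toℕ v then x else 0
    forward : ℕ
    forward = ΣFin n (λ u → ΣFin n (λ v → guard u v (h u v)))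

Monotone : (ℕ → Bool) → Set
Monotone g = ∀ k → g k ≡ true → g (suc k) ≡ true

monotone-≤ : ∀ {g} → Monotone g → ∀ {j k} → j ≤ k → g j ≡ true → g k ≡ true
monotone-≤ {g} mono j≤k = go (≤⇒≤′ j≤k)
  where
  go : ∀ {j k} → j ≤′ k → g j ≡ true → g k ≡ true
  go ≤′-refl      gj = gj
  go (≤′-step j≤k) gj = mono _ (go j≤k gj)

countFalse : ℕ → (ℕ → Bool) → ℕ
countFalse n g = ΣFin n (λ i → if g (toℕ i) then 0 else 1)

countFalse-≤ : ∀ n {g} → Monotone g → ∀ k → g k ≡ true → countFalse n g ≤ k
countFalse-≤ zero    mono k       gk = z≤n
countFalse-≤ (suc n) mono zero    gk rewrite gk =
  countFalse-≤ n (λ j → mono (suc j)) zero (mono zero gk)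
countFalse-≤ (suc n) {g} mono (suc k) gk =
  +-mono-≤ (0/1≤1 (g 0)) (countFalse-≤ n (λ j → mono (suc j)) k gk)
  where
  0/1≤1 : ∀ b → (if b then 0 else 1) ≤ 1
  0/1≤1 true  = z≤n
  0/1≤1 false = s≤s z≤n

countFalse-> : ∀ n {g} → Monotone g → ∀ k → g k ≡ false → k < n → k < countFalse n g
countFalse-> (suc n) {g} mono k gk k<n with g 0 in g0
... | true = ⊥-elim (true≢false (monotone-≤ mono z≤n g0) gk)
countFalse-> (suc n) mono zero    gk k<n       | false = s≤s z≤n
countFalse-> (suc n) mono (suc k) gk (s≤s k<n) | false =
  s≤s (countFalse-> n (λ j → mono (suc j)) k gk k<n)

Adj : ∀ {n} → Graph n → Fin n → Fin n → Set
Adj G u v = adj G u v ≡ true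

module _ {n : ℕ} (G : Graph n) where

  Adj-sym : ∀ {u v} → Adj G u v → Adj G v u
  Adj-sym {u} {v} a = trans (Graph.sym G v u) a

  Adj-irrefl : ∀ {u v} → Adj G u v → u ≢ v
  Adj-irrefl {u} a refl = true≢false a (Graph.irrefl G u)

  reach-suc : ∀ u v → Monotone (λ k → reach G k u v)
  reach-suc u v k = ∨-trueˡ _

  reach-mono : ∀ {j k} u v → j ≤ k → reach G j u v ≡ true → reach G k u v ≡ true
  reach-mono u v = monotone-≤ (reach-suc u v)

  reach-refl : ∀ u → reach G 0 u u ≡ true
  reach-refl u with u ≟ᶠ u
  ... | yes _  = refl
  ... | no u≢u = ⊥-elim (u≢u refl)

  reach-zero⁻ : ∀ u v → reach G 0 u v ≡ true → u ≡ v
  reach-zero⁻ u v r with u ≟ᶠ v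
  ... | yes u≡v = u≡v

  reach-snoc : ∀ k u w v → reach G k u w ≡ true → Adj G w v → reach G (suc k) u v ≡ true
  reach-snoc k u w v r a = ∨-trueʳ (reach G k u v) (AnyFin-true⁺ n _ w (∧-true⁺ r a))

  reach-suc⁻ : ∀ k u v → reach G (suc k) u v ≡ true →
    reach G k u v ≡ true ⊎ ∃ λ w → reach G k u w ≡ true × Adj G w v
  reach-suc⁻ k u v r with ∨-true⁻ (reach G k u v) r
  ... | inj₁ r′ = inj₁ r′
  ... | inj₂ any with AnyFin-true⁻ n _ any
  ...   | w , rw∧a = inj₂ (w , ∧-true⁻ _ rw∧a)

  reach-cons : ∀ k u w v → Adj G u w → reach G k w v ≡ true → reach G (suc k) u v ≡ true
  reach-cons zero u w v a r rewrite reach-zero⁻ w v r = reach-snoc 0 u u v (reach-refl u) a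
  reach-cons (suc k) u w v a r with reach-suc⁻ k w v r
  ... | inj₁ r′ = reach-suc u v (suc k) (reach-cons k u w v a r′)
  ... | inj₂ (x , rx , xv) = reach-snoc (suc k) u x v (reach-cons k u w x a rx) xv

  reach-sym : ∀ k u v → reach G k u v ≡ true → reach G k v u ≡ true
  reach-sym zero u v r rewrite reach-zero⁻ u v r = reach-refl v
  reach-sym (suc k) u v r with reach-suc⁻ k u v r
  ... | inj₁ r′ = reach-suc v u k (reach-sym k u v r′)
  ... | inj₂ (w , rw , wv) = reach-cons k v w u (Adj-sym wv) (reach-sym k u w rw)

  reach-closed : (P : Fin n → Set) → (∀ {a b} → P a → Adj G a b → P b) →
    ∀ k u v → P u → reach G k u v ≡ true → P v
  reach-closed P closed zero u v Pu r rewrite reach-zero⁻ u v r = Pu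
  reach-closed P closed (suc k) u v Pu r with reach-suc⁻ k u v r
  ... | inj₁ r′ = reach-closed P closed k u v Pu r′
  ... | inj₂ (w , rw , wv) = closed (reach-closed P closed k u w Pu rw) wv

  reachCount : Fin n → ℕ → ℕ
  reachCount r k = ΣFin n (λ v → ind (reach G k r v))

  Stable : Fin n → ℕ → Set
  Stable r k = ∀ v → reach G (suc k) r v ≡ reach G k r v

  stable-suc : ∀ r k → Stable r k → Stable r (suc k)
  stable-suc r k s v =
    cong₂ _∨_ (s v) (AnyFin-cong n (λ w → cong (_∧ adj G w v) (s w)))

  stable-+ : ∀ r k → Stable r k → ∀ j → Stable r (j + k)
  stable-+ r k s zero    = s
  stable-+ r k s (suc j) = stable-suc r (j + k) (stable-+ r k s j)

  stable⇒reach : ∀ r k → Stable r k → ∀ K v → reach G K r v ≡ true → reach G k r v ≡ true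
  stable⇒reach r k s K v rK with K ≤? k
  ... | yes K≤k = reach-mono r v K≤k rK
  ... | no  K≰k = trans (sym (reach-K≡reach-k (K ∸ k)))
                        (subst (λ j → reach G j r v ≡ true) (sym (m∸n+n≡m (≰⇒≥ K≰k))) rK)
    where
    reach-K≡reach-k : ∀ j → reach G (j + k) r v ≡ reach G k r v
    reach-K≡reach-k zero    = refl
    reach-K≡reach-k (suc j) = trans (stable-+ r k s j v) (reach-K≡reach-k j)

  full⇒reach : ∀ r k → n ≤ reachCount r k → ∀ v → reach G k r v ≡ true
  full⇒reach r k n≤count v = ind≡1⇒true (ΣFin-mono-≡⇒≡ n (λ w → ind≤1 _) count≡n v)
    where
    count≡n : reachCount r k ≡ ΣFin n (λ _ → 1)
    count≡n = ≤-antisym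
      (≤-trans (ΣFin-mono n (λ w → ind≤1 _)) ≤-refl)
      (≤-trans (≤-reflexive (trans (ΣFin-const n 1) (*-identityʳ n))) n≤count)
    ind≡1⇒true : ∀ {b} → ind b ≡ 1 → b ≡ true
    ind≡1⇒true {true} _ = refl

  reach-ind-suc : ∀ r k v → ind (reach G k r v) ≤ ind (reach G (suc k) r v)
  reach-ind-suc r k v with reach G k r v
  ... | true  = s≤s z≤n
  ... | false = z≤n

  reachCount-grows : ∀ r k → k < reachCount r k ⊎ Stable r k
  reachCount-grows r zero =
    inj₁ (≤-trans (≤-reflexive (cong ind (sym (reach-refl r)))) (term≤ΣFin n _ r))
  reachCount-grows r (suc k) with reachCount-grows r k
  ... | inj₂ s = inj₂ (stable-suc r k s)
  ... | inj₁ k<count with reachCount r (suc k) ≟ reachCount r k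
  ...   | yes same = inj₂ (stable-suc r k (λ v → ind-injective
                       (sym (ΣFin-mono-≡⇒≡ n (reach-ind-suc r k) (sym same) v))))
  ...   | no  grew =
    inj₁ (≤-trans (s≤s k<count) (≤∧≢⇒< (ΣFin-mono n (reach-ind-suc r k)) (grew ∘ sym)))

  module _ (conn : Connected G) where

    -- The ball of radius k around u grows at each step until it stops changing for good,
    -- so radius n − 1 already contains every vertex.
    connected⇒reach : ∀ u v → reach G (n ∸ 1) u v ≡ true
    connected⇒reach u v with reachCount-grows u (n ∸ 1)
    ... | inj₁ n∸1<count = full⇒reach u (n ∸ 1) (≤-trans (m≤n+m∸n n 1) n∸1<count) v
    ... | inj₂ s         = stable⇒reach u (n ∸ 1) s (proj₁ (conn u v)) v (proj₂ (conn u v))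

    dist-≤ : ∀ k u v → reach G k u v ≡ true → dist G u v ≤ k
    dist-≤ k u v = countFalse-≤ n (reach-suc u v) k

    reach-dist : ∀ k u v → dist G u v ≤ k → reach G k u v ≡ true
    reach-dist k u v d≤k with reach G k u v in rk
    ... | true  = refl
    ... | false with k <? n
    ...   | yes k<n = ⊥-elim (≤⇒≯ d≤k (countFalse-> n (reach-suc u v) k rk k<n))
    ...   | no  k≮n = ⊥-elim (true≢false
                        (reach-mono u v (≤-trans (m∸n≤m n 1) (≮⇒≥ k≮n)) (connected⇒reach u v)) rk)

    dist-reach : ∀ u v → reach G (dist G u v) u v ≡ true
    dist-reach u v = reach-dist (dist G u v) u v ≤-refl

    dist-sym : ∀ u v → dist G u v ≡ dist G v u
    dist-sym u v = ≤-antisym (dist-≤ (dist G v u) u v (reach-sym (dist G v u) v u (dist-reach v u)))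
                             (dist-≤ (dist G u v) v u (reach-sym (dist G u v) u v (dist-reach u v)))

    dist-self : ∀ u → dist G u u ≡ 0
    dist-self u = n≤0⇒n≡0 (dist-≤ 0 u u (reach-refl u))

    dist≡0⇒≡ : ∀ u v → dist G u v ≡ 0 → u ≡ v
    dist≡0⇒≡ u v d≡0 = reach-zero⁻ u v (reach-dist 0 u v (≤-reflexive d≡0))

    dist-adj-≤ : ∀ r u v → Adj G u v → dist G r v ≤ suc (dist G r u)
    dist-adj-≤ r u v a = dist-≤ _ r v (reach-snoc (dist G r u) r u v (dist-reach r u) a)

    dist-predecessor : ∀ r v k → dist G r v ≡ suc k → ∃ λ p → Adj G p v × dist G r p ≡ k
    dist-predecessor r v k d≡1+k
      with reach-suc⁻ k r v (subst (λ j → reach G j r v ≡ true) d≡1+k (dist-reach r v))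
    ... | inj₁ rv = ⊥-elim (1+n≰n (subst (_≤ k) d≡1+k (dist-≤ k r v rv)))
    ... | inj₂ (p , rp , pv) with m≤n⇒m<n∨m≡n (dist-≤ k r p rp)
    ...   | inj₂ dp≡k = p , pv , dp≡k
    ...   | inj₁ dp<k = ⊥-elim (1+n≰n (subst (_≤ k) d≡1+k (≤-trans (dist-adj-≤ r p v pv) dp<k)))

    dist-≢ : ∀ u v → u ≢ v → 1 ≤ dist G u v
    dist-≢ u v u≢v with dist G u v in d
    ... | zero  = ⊥-elim (u≢v (dist≡0⇒≡ u v d))
    ... | suc _ = s≤s z≤n

    dist-nonadjacent : ∀ u v → u ≢ v → adj G u v ≡ false → 2 ≤ dist G u v
    dist-nonadjacent u v u≢v ¬uv with dist G u v in d
    ... | zero = ⊥-elim (u≢v (dist≡0⇒≡ u v d))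
    ... | suc (suc _) = s≤s (s≤s z≤n)
    ... | suc zero with reach-suc⁻ 0 u v (reach-dist 1 u v (≤-reflexive d))
    ...   | inj₁ r0 = ⊥-elim (u≢v (reach-zero⁻ u v r0))
    ...   | inj₂ (w , rw , wv) rewrite reach-zero⁻ u w rw = ⊥-elim (true≢false wv ¬uv)

module _ {A : Set} where

  lastOr : A → List A → A
  lastOr d []       = d
  lastOr d (x ∷ xs) = lastOr x xs

  lastOr-∷ʳ : ∀ d xs z → lastOr d (xs ++ z ∷ []) ≡ z
  lastOr-∷ʳ d []       z = refl
  lastOr-∷ʳ d (x ∷ xs) z = lastOr-∷ʳ x xs z

  lookup-last : ∀ x xs → lookup (x ∷ xs) (fromℕ (length xs)) ≡ lastOr x xs
  lookup-last x []       = refl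
  lookup-last x (y ∷ ys) = lookup-last y ys

  All⇒∉ : ∀ {P : A → Set} {z xs} → All P xs → ¬ P z → z ∉ xs
  All⇒∉ all ¬Pz z∈xs = ¬Pz (All.lookup all z∈xs)

  Unique-∷ : ∀ {x : A} {xs} → x ∉ xs → Unique xs → Unique (x ∷ xs)
  Unique-∷ {xs = xs} x∉xs u = ¬Any⇒All¬ xs x∉xs ∷ u

  Unique-∷ʳ : ∀ {xs : List A} {z} → Unique xs → z ∉ xs → Unique (xs ++ z ∷ [])
  Unique-∷ʳ u z∉xs = Unique.++⁺ u ([] ∷ []) λ { (z∈xs , here refl) → z∉xs z∈xs }

  Unique-lookup-injective : ∀ {xs : List A} → Unique xs → ∀ i j → lookup xs i ≡ lookup xs j → i ≡ j
  Unique-lookup-injective {x ∷ xs} _          zero    zero    _ = refl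
  Unique-lookup-injective {x ∷ xs} (x∉xs ∷ _) zero    (suc j) e = ⊥-elim (All.lookup x∉xs (∈-lookup j) e)
  Unique-lookup-injective {x ∷ xs} (x∉xs ∷ _) (suc i) zero    e = ⊥-elim (All.lookup x∉xs (∈-lookup i) (sym e))
  Unique-lookup-injective {x ∷ xs} (_ ∷ u)    (suc i) (suc j) e = cong suc (Unique-lookup-injective u i j e)

  module _ {R : A → A → Set} where

    Linked-∷ʳ : ∀ x xs {z} → Linked R (x ∷ xs) → R (lastOr x xs) z → Linked R (x ∷ xs ++ z ∷ [])
    Linked-∷ʳ x []       _         r = r ∷ [-]
    Linked-∷ʳ x (y ∷ ys) (rxy ∷ l) r = rxy ∷ Linked-∷ʳ y ys l r

    Linked-lookup : ∀ x xs → Linked R (x ∷ xs) → (i : Fin (length xs)) →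
      R (lookup (x ∷ xs) (inject₁ i)) (lookup (x ∷ xs) (suc i))
    Linked-lookup x (y ∷ ys) (rxy ∷ l) zero    = rxy
    Linked-lookup x (y ∷ ys) (rxy ∷ l) (suc i) = Linked-lookup y ys l i

module _ {n : ℕ} (G : Graph n) (tree : IsTree G) where

  no-cycle : ∀ a b c rest → Unique (a ∷ b ∷ c ∷ rest) → Linked (Adj G) (a ∷ b ∷ c ∷ rest) →
    Adj G (lastOr c rest) a → ⊥
  no-cycle a b c rest u l close = proj₂ tree record
    { m     = length rest
    ; c     = lookup (a ∷ b ∷ c ∷ rest)
    ; inj   = λ {i} {j} → Unique-lookup-injective u i j
    ; step  = Linked-lookup a (b ∷ c ∷ rest) l
    ; close = subst (λ z → Adj G z a) (sym (lookup-last a (b ∷ c ∷ rest))) close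
    }

  module Levels (r : Fin n) where

    level : Fin n → ℕ
    level = dist G r

    ∉-above : ∀ {k w xs} → All (λ x → suc k ≤ level x) xs → level w ≡ k → w ∉ xs
    ∉-above {k} above lw = All⇒∉ above (λ 1+k≤lw → 1+n≰n (subst (suc k ≤_) lw 1+k≤lw))

    -- If the endpoints were distinct, replacing them by their parents gives a longer such path
    -- one level lower; once the two parents coincide the path closes into a cycle.
    path-above-level-trivial : ∀ j x t → Unique (x ∷ t) → Linked (Adj G) (x ∷ t) →
      All (λ w → j ≤ level w) (x ∷ t) → level x ≡ j → level (lastOr x t) ≡ j → x ≡ lastOr x t
    path-above-level-trivial zero x t _ _ _ lx ly =
      trans (sym (dist≡0⇒≡ G (proj₁ tree) r x lx)) (dist≡0⇒≡ G (proj₁ tree) r _ ly)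
    path-above-level-trivial (suc k) x [] _ _ _ _ _ = refl
    path-above-level-trivial (suc k) x (q ∷ rest) u l above lx ly
      with dist-predecessor G (proj₁ tree) r x k lx
         | dist-predecessor G (proj₁ tree) r (lastOr q rest) k ly
    ... | px , px~x , lpx | py , py~y , lpy with px ≟ᶠ py
    ...   | yes refl = ⊥-elim (no-cycle px x q rest (Unique-∷ (∉-above above lpx) u) (px~x ∷ l) (Adj-sym G py~y))
    ...   | no px≢py = ⊥-elim (px≢py (trans
              (path-above-level-trivial k px (x ∷ q ∷ rest ++ py ∷ []) unique linked above′ lpx lpy′)
              (lastOr-∷ʳ px (x ∷ q ∷ rest) py)))
      where
      unique : Unique (px ∷ (x ∷ q ∷ rest) ++ py ∷ [])
      unique = Unique-∷ (λ px∈ → case ∈-++⁻ (x ∷ q ∷ rest) px∈ of λ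
                           { (inj₁ px∈path)   → ∉-above above lpx px∈path
                           ; (inj₂ (here e)) → px≢py e })
                        (Unique-∷ʳ u (∉-above above lpy))
      linked : Linked (Adj G) (px ∷ (x ∷ q ∷ rest) ++ py ∷ [])
      linked = px~x ∷ Linked-∷ʳ x (q ∷ rest) l (Adj-sym G py~y)
      above′ : All (λ w → k ≤ level w) (px ∷ (x ∷ q ∷ rest) ++ py ∷ [])
      above′ = ≤-reflexive (sym lpx) ∷ ∷ʳ⁺ (All.map (≤-trans (n≤1+n k)) above) (≤-reflexive (sym lpy))
      lpy′ : level (lastOr px ((x ∷ q ∷ rest) ++ py ∷ [])) ≡ k
      lpy′ = trans (cong level (lastOr-∷ʳ px (x ∷ q ∷ rest) py)) lpy

    adj-level-≢ : ∀ {u v} → Adj G u v → level u ≢ level v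
    adj-level-≢ {u} {v} u~v lu≡lv = Adj-irrefl G u~v
      (path-above-level-trivial (level u) u (v ∷ [])
        (Unique-∷ (λ { (here u≡v) → Adj-irrefl G u~v u≡v }) ([] ∷ []))
        (u~v ∷ [-]) (≤-refl ∷ ≤-reflexive lu≡lv ∷ []) refl (sym lu≡lv))

    adj-level : ∀ {u v} → Adj G u v → level v ≡ suc (level u) ⊎ level u ≡ suc (level v)
    adj-level {u} {v} u~v with <-cmp (level u) (level v)
    ... | tri< lu<lv _ _ = inj₁ (≤-antisym (dist-adj-≤ G (proj₁ tree) r u v u~v) lu<lv)
    ... | tri≈ _ lu≡lv _ = ⊥-elim (adj-level-≢ u~v lu≡lv)
    ... | tri> _ _ lv<lu = inj₂ (≤-antisym (dist-adj-≤ G (proj₁ tree) r v u (Adj-sym G u~v)) lv<lu)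

    parent-unique : ∀ {a b v k} → Adj G a v → Adj G b v →
      level a ≡ k → level b ≡ k → level v ≡ suc k → a ≡ b
    parent-unique {a} {b} {v} {k} a~v b~v la lb lv with a ≟ᶠ b
    ... | yes a≡b = a≡b
    ... | no  a≢b = path-above-level-trivial k a (v ∷ b ∷ [])
          (Unique-∷ (λ { (here refl) → v≢ la ; (there (here a≡b)) → a≢b a≡b })
                    (Unique-∷ (λ { (here refl) → v≢ lb }) ([] ∷ [])))
          (a~v ∷ Adj-sym G b~v ∷ [-])
          (≤-reflexive (sym la) ∷ ≤-trans (n≤1+n k) (≤-reflexive (sym lv)) ∷ ≤-reflexive (sym lb) ∷ [])
          la lb
      where
      v≢ : level v ≡ k → ⊥
      v≢ lv′ = 1+n≰n (≤-reflexive (trans (sym lv) lv′))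

edgeCount : ∀ {n} → Graph n → ℕ
edgeCount G = ΣPairs G (λ u v → ind (adj G u v))

module _ {n : ℕ} (G : Graph n) (tree : IsTree G) where

  -- Orient every edge from its endpoint nearer to r: each vertex then has at most one
  -- incoming edge, and r has none.
  edgeCount<n : Fin n → edgeCount G < n
  edgeCount<n r = begin-strict
    edgeCount G                              ≤⟨ ΣPairs-≤-oriented G child adj≤child+child ⟩
    ΣFin n (λ u → ΣFin n (child u))          ≡⟨ ΣFin-swap n n child ⟩
    ΣFin n (λ v → ΣFin n (λ u → child u v))  <⟨ ΣFin<n n _ parents≤1 r (ΣFin-zero n child-root) ⟩
    n                                        ∎
    where
    open ≤-Reasoning
    open Levels G tree r

    child : Fin n → Fin n → ℕ
    child u v = ind (adj G u v ∧ ⌊ level v ≟ suc (level u) ⌋)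

    child-≥1⇒ : ∀ u v → 1 ≤ child u v → Adj G u v × level v ≡ suc (level u)
    child-≥1⇒ u v 1≤c with adj G u v | level v ≟ suc (level u)
    ... | true  | yes lv = refl , lv
    ... | true  | no  _  = ⊥-elim (n≮0 1≤c)
    ... | false | _      = ⊥-elim (n≮0 1≤c)

    child-≡1 : ∀ {u v} → Adj G u v → level v ≡ suc (level u) → child u v ≡ 1
    child-≡1 {u} {v} u~v lv with level v ≟ suc (level u)
    ... | yes _   rewrite u~v = refl
    ... | no  ¬lv = ⊥-elim (¬lv lv)

    adj≤child+child : ∀ u v → ind (adj G u v) ≤ child u v + child v u
    adj≤child+child u v = edge-oriented (adj G u v) refl
      where
      edge-oriented : ∀ b → adj G u v ≡ b → ind b ≤ child u v + child v u
      edge-oriented false _ = z≤n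
      edge-oriented true u~v with adj-level u~v
      ... | inj₁ lv = ≤-trans (≤-reflexive (sym (child-≡1 u~v lv))) (m≤m+n _ _)
      ... | inj₂ lu = ≤-trans (≤-reflexive (sym (child-≡1 (Adj-sym G u~v) lu))) (m≤n+m _ _)

    child-root : ∀ u → child u r ≡ 0
    child-root u = n≤0⇒n≡0 (≮⇒≥ λ 1≤c →
      0≢1+n (trans (sym (dist-self G (proj₁ tree) r)) (proj₂ (child-≥1⇒ u r 1≤c))))

    parents≤1 : ∀ v → ΣFin n (λ u → child u v) ≤ 1
    parents≤1 v = ΣFin-≤1 n _ (λ u → ind≤1 _) λ a b ca cb →
      let (a~v , la) = child-≥1⇒ a v ca ; (b~v , lb) = child-≥1⇒ b v cb in
      parent-unique a~v b~v refl (suc-injective (trans (sym lb) la)) la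

avoid-two : ∀ {m} → 3 ≤ m → (u v : Fin m) → ∃ λ z → z ≢ u × z ≢ v
avoid-two (s≤s (s≤s (s≤s _))) u v with 0F ≟ᶠ u | 0F ≟ᶠ v
... | no 0≢u   | no 0≢v = 0F , 0≢u , 0≢v
... | yes refl | yes refl = 1F , (λ ()) , (λ ())
... | yes refl | no _ with 1F ≟ᶠ v
...   | no 1≢v   = 1F , (λ ()) , 1≢v
...   | yes refl = 2F , (λ ()) , (λ ())
avoid-two (s≤s (s≤s (s≤s _))) u v | no _ | yes refl with 1F ≟ᶠ u
...   | no 1≢u   = 1F , 1≢u , (λ ())
...   | yes refl = 2F , (λ ()) , (λ ())

module _ {n : ℕ} (G : Graph n) where

  ecc≤diam : ∀ u → ecc G u ≤ diam G
  ecc≤diam = MaxFin-≥ n (ecc G)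

  ecc<diam : ∀ {u} → ecc G u ≢ diam G → ecc G u ≤ diam G ∸ 1
  ecc<diam {u} ne = ∸-monoˡ-≤ 1 (≤∧≢⇒< (ecc≤diam u) ne)

  dist≤diam : ∀ u v → dist G u v ≤ diam G
  dist≤diam u v = ≤-trans (MaxFin-≥ n (dist G u) v) (ecc≤diam u)

module _ {n : ℕ} (G : Graph n) (tree : IsTree G) where

  -- Rooted at a vertex x farthest from u, u lies on the deepest level, so all neighbours of u
  -- are parents of u.
  peripheral-leaf : ∀ {u v w} → ecc G u ≡ diam G → Adj G u v → Adj G u w → w ≡ v
  peripheral-leaf {u} {v} {w} eu u~v u~w with MaxFin-attained n (dist G u) u
  ... | x , ecc≡dist = parent-unique (Adj-sym G u~w) (Adj-sym G u~v) lw≡lv refl (descend u~v)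
    where
    open Levels G tree x
    level-u : level u ≡ diam G
    level-u = trans (dist-sym G (proj₁ tree) x u) (trans (sym ecc≡dist) eu)
    descend : ∀ {y} → Adj G u y → level u ≡ suc (level y)
    descend {y} u~y with adj-level u~y
    ... | inj₂ lu = lu
    ... | inj₁ ly = ⊥-elim (1+n≰n (subst (_≤ diam G) (trans ly (cong suc level-u)) (dist≤diam G x y)))
    lw≡lv : level w ≡ level v
    lw≡lv = suc-injective (trans (sym (descend u~w)) (descend u~v))

  adjacent-not-both-peripheral : 3 ≤ n → ∀ {u v} → Adj G u v →
    ecc G u ≡ diam G → ecc G v ≡ diam G → ⊥
  adjacent-not-both-peripheral 3≤n {u} {v} u~v eu ev with avoid-two 3≤n u v
  ... | z , z≢u , z≢v = [ z≢u , z≢v ]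
        (reach-closed G (λ x → x ≡ u ⊎ x ≡ v) closed (n ∸ 1) u z (inj₁ refl)
                      (connected⇒reach G (proj₁ tree) u z))
    where
    closed : ∀ {a b} → a ≡ u ⊎ a ≡ v → Adj G a b → b ≡ u ⊎ b ≡ v
    closed (inj₁ refl) a~b = inj₂ (peripheral-leaf eu u~v a~b)
    closed (inj₂ refl) a~b = inj₁ (peripheral-leaf ev (Adj-sym G u~v) a~b)

  ecc*ecc≤ : 3 ≤ n → ∀ {u v} → Adj G u v → ecc G u * ecc G v ≤ diam G * (diam G ∸ 1)
  ecc*ecc≤ 3≤n {u} {v} u~v with ecc G u ≟ diam G | ecc G v ≟ diam G
  ... | yes eu | yes ev = ⊥-elim (adjacent-not-both-peripheral 3≤n u~v eu ev)
  ... | no  eu | _      = ≤-trans (*-mono-≤ (ecc<diam G eu) (ecc≤diam G v)) (≤-reflexive (*-comm _ (diam G)))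
  ... | yes _  | no  ev = *-mono-≤ (ecc≤diam G u) (ecc<diam G ev)

diameter-condition : ∀ n d → 1 ≤ n → (2 * d ∸ 1) ^ 2 ≤ 4 * n ∸ 3 → d * (d ∸ 1) ≤ n ∸ 1
diameter-condition n zero    _   _ = z≤n
diameter-condition n (suc e) 1≤n h = begin
  suc e * e           ≡⟨ sym (m+n∸n≡m (suc e * e) 1) ⟩
  suc e * e + 1 ∸ 1   ≤⟨ ∸-monoˡ-≤ 1 (*-cancelˡ-≤ {suc e * e + 1} {n} 4 four-times) ⟩
  n ∸ 1               ∎
  where
  open ≤-Reasoning
  square-identity : ∀ e → 4 * (suc e * e + 1) ≡ suc (2 * e) * suc (2 * e) + 3
  square-identity = solve-∀
  four-times : 4 * (suc e * e + 1) ≤ 4 * n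
  four-times = begin
    4 * (suc e * e + 1)        ≡⟨ square-identity e ⟩
    suc (2 * e) * suc (2 * e) + 3
      ≡⟨ cong (λ x → suc (2 * e) * x + 3) (sym (*-identityʳ (suc (2 * e)))) ⟩
    suc (2 * e) ^ 2 + 3        ≡⟨ cong (λ x → x ^ 2 + 3) (cong (_∸ 1) (sym (*-suc 2 e))) ⟩
    (2 * suc e ∸ 1) ^ 2 + 3    ≤⟨ +-monoˡ-≤ 3 h ⟩
    4 * n ∸ 3 + 3              ≡⟨ m∸n+n≡m (≤-trans (n≤1+n 3) (*-monoʳ-≤ 4 1≤n)) ⟩
    4 * n                      ∎

product≤complement : ∀ n {m w} → m ≤ n ∸ 1 → w + m ≡ n * (n ∸ 1) → (n ∸ 1) * m ≤ w
product≤complement zero    _   _ = z≤n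
product≤complement (suc p) {m} {w} m≤p w+m≡ = +-cancelˡ-≤ m (p * m) w (begin
  suc p * m   ≤⟨ *-monoʳ-≤ (suc p) m≤p ⟩
  suc p * p   ≡⟨ sym w+m≡ ⟩
  w + m       ≡⟨ +-comm w m ⟩
  m + w       ∎)
  where open ≤-Reasoning

product≡complement⇒m≡n∸1 : ∀ n {m w} → w + m ≡ n * (n ∸ 1) → (n ∸ 1) * m ≡ w → m ≡ n ∸ 1
product≡complement⇒m≡n∸1 zero    {m} {w} w+m≡0 _ = m+n≡0⇒n≡0 w w+m≡0
product≡complement⇒m≡n∸1 (suc p) {m} {w} w+m≡ pm≡w = *-cancelˡ-≡ m p (suc p) (begin
  suc p * m   ≡⟨ cong (m +_) pm≡w ⟩
  m + w       ≡⟨ +-comm m w ⟩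
  w + m       ≡⟨ w+m≡ ⟩
  suc p * p   ∎)
  where open ≡-Reasoning

pairWeight : ∀ {n} → Graph n → ℕ
pairWeight G = ΣPairs G (λ u v → if adj G u v then 1 else 2)

module _ {n : ℕ} (G : Graph n) where

  pairWeight+edgeCount : pairWeight G + edgeCount G ≡ n * (n ∸ 1)
  pairWeight+edgeCount = ΣPairs-complementary G _ _ λ u v → weight+ind (adj G u v)
    where
    weight+ind : ∀ b → (if b then 1 else 2) + ind b ≡ 2
    weight+ind true  = refl
    weight+ind false = refl

  module _ (conn : Connected G) where

    weight≤dist : ∀ u v → toℕ u < toℕ v → (if adj G u v then 1 else 2) ≤ dist G u v
    weight≤dist u v u<v with adj G u v in uv
    ... | true  = dist-≢ G conn u v (Fin.<⇒≢ u<v)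
    ... | false = dist-nonadjacent G conn u v (Fin.<⇒≢ u<v) uv

    pairWeight≤W : pairWeight G ≤ W G
    pairWeight≤W = ΣPairs-mono G weight≤dist

    W≤pairWeight⇒diam≤2 : W G ≤ pairWeight G → diam G ≤ 2
    W≤pairWeight⇒diam≤2 W≤ = MaxFin-lub n λ u → MaxFin-lub n λ v → dist≤2 u v
      where
      dist≡weight : ∀ u v → toℕ u < toℕ v → (if adj G u v then 1 else 2) ≡ dist G u v
      dist≡weight = ΣPairs-mono-≡⇒≡ G weight≤dist (≤-antisym pairWeight≤W W≤)
      weight≤2 : ∀ b → (if b then 1 else 2) ≤ 2
      weight≤2 true  = s≤s z≤n
      weight≤2 false = ≤-refl
      dist≤2 : ∀ u v → dist G u v ≤ 2
      dist≤2 u v with <-cmp (toℕ u) (toℕ v)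
      ... | tri< u<v _ _ = subst (_≤ 2) (dist≡weight u v u<v) (weight≤2 _)
      ... | tri> _ _ v<u = subst (_≤ 2) (trans (dist≡weight v u v<u) (dist-sym G conn v u)) (weight≤2 _)
      ... | tri≈ _ u≡v _ rewrite Fin.toℕ-injective u≡v | dist-self G conn v = z≤n

module _ {n : ℕ} (G : Graph n) (3≤n : 3 ≤ n) (tree : IsTree G)
         (diam-small : diam G * (diam G ∸ 1) ≤ n ∸ 1) where

  private
    D = diam G * (diam G ∸ 1)
    m = edgeCount G

  E₂≤D*edgeCount : E₂ G ≤ D * m
  E₂≤D*edgeCount = ≤-trans (ΣPairs-mono G bound)
                           (≤-reflexive (ΣPairs-distribˡ-* G D (λ u v → ind (adj G u v))))
    where
    bound : ∀ u v → toℕ u < toℕ v → (if adj G u v then ecc G u * ecc G v else 0) ≤ D * ind (adj G u v)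
    bound u v _ with adj G u v in uv
    ... | true  = ≤-trans (ecc*ecc≤ G tree 3≤n uv) (≤-reflexive (sym (*-identityʳ D)))
    ... | false = z≤n

  edgeCount≤n∸1 : m ≤ n ∸ 1
  edgeCount≤n∸1 = ∸-monoˡ-≤ 1 (edgeCount<n G tree (fromℕ< (≤-trans (s≤s z≤n) 3≤n)))

  pred-n*edgeCount≤pairWeight : (n ∸ 1) * m ≤ pairWeight G
  pred-n*edgeCount≤pairWeight = product≤complement n edgeCount≤n∸1 (pairWeight+edgeCount G)

  E₂≤W : E₂ G ≤ W G
  E₂≤W = begin
    E₂ G            ≤⟨ E₂≤D*edgeCount ⟩
    D * m           ≤⟨ *-monoˡ-≤ m diam-small ⟩
    (n ∸ 1) * m     ≤⟨ pred-n*edgeCount≤pairWeight ⟩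
    pairWeight G    ≤⟨ pairWeight≤W G (proj₁ tree) ⟩
    W G             ∎
    where open ≤-Reasoning

  E₂≡W⇒n≡3×edgeCount≡2 : E₂ G ≡ W G → n ≡ 3 × m ≡ 2
  E₂≡W⇒n≡3×edgeCount≡2 E₂≡W = n≡3 , trans m≡n∸1 n∸1≡2
    where
    W≤D*m : W G ≤ D * m
    W≤D*m = ≤-trans (≤-reflexive (sym E₂≡W)) E₂≤D*edgeCount
    D*m≤pm : D * m ≤ (n ∸ 1) * m
    D*m≤pm = *-monoˡ-≤ m diam-small
    pairWeight≤pm : pairWeight G ≤ (n ∸ 1) * m
    pairWeight≤pm = ≤-trans (pairWeight≤W G (proj₁ tree)) (≤-trans W≤D*m D*m≤pm)

    m≡n∸1 : m ≡ n ∸ 1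
    m≡n∸1 = product≡complement⇒m≡n∸1 n (pairWeight+edgeCount G)
              (≤-antisym pred-n*edgeCount≤pairWeight pairWeight≤pm)

    D≡n∸1 : D ≡ n ∸ 1
    D≡n∸1 = *-cancelʳ-≡ D (n ∸ 1) m {{>-nonZero m>0}}
              (≤-antisym D*m≤pm (≤-trans pred-n*edgeCount≤pairWeight
                                   (≤-trans (pairWeight≤W G (proj₁ tree)) W≤D*m)))
      where
      m>0 : 0 < m
      m>0 = subst (0 <_) (sym m≡n∸1) (≤-trans (s≤s z≤n) (∸-monoˡ-≤ 1 3≤n))

    diam≤2 : diam G ≤ 2
    diam≤2 = W≤pairWeight⇒diam≤2 G (proj₁ tree)
               (≤-trans W≤D*m (≤-trans D*m≤pm pred-n*edgeCount≤pairWeight))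

    n∸1≡2 : n ∸ 1 ≡ 2
    n∸1≡2 = ≤-antisym (subst (_≤ 2) D≡n∸1 (*-mono-≤ diam≤2 (∸-monoˡ-≤ 1 diam≤2)))
                      (∸-monoˡ-≤ 1 3≤n)

    n≡3 : n ≡ 3
    n≡3 = ≤-antisym (≤-trans (m≤n+m∸n n 1) (s≤s (≤-reflexive n∸1≡2))) 3≤n

module _ {n : ℕ} (G H : Graph n) (same : ∀ u v → adj G u v ≡ adj H u v) where

  reach-cong : ∀ k u v → reach G k u v ≡ reach H k u v
  reach-cong zero    u v = refl
  reach-cong (suc k) u v =
    cong₂ _∨_ (reach-cong k u v) (AnyFin-cong n λ w → cong₂ _∧_ (reach-cong k u w) (same w v))

  dist-cong : ∀ u v → dist G u v ≡ dist H u v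
  dist-cong u v = ΣFin-cong n λ k → cong (if_then 0 else 1) (reach-cong (toℕ k) u v)

  W-cong : W G ≡ W H
  W-cong = ΣPairs-cong G dist-cong

  E₂-cong : E₂ G ≡ E₂ H
  E₂-cong = ΣPairs-cong G λ u v →
    cong₂ (if_then_else 0) (same u v) (cong₂ _*_ (ecc-cong u) (ecc-cong v))
    where
    ecc-cong : ∀ u → ecc G u ≡ ecc H u
    ecc-cong u = MaxFin-cong n (dist-cong u)

  E₂≡W-cong : E₂ H ≡ W H → E₂ G ≡ W G
  E₂≡W-cong E₂≡W = trans E₂-cong (trans E₂≡W (sym W-cong))

  edgeCount-cong : edgeCount G ≡ edgeCount H
  edgeCount-cong = ΣPairs-cong G λ u v → cong ind (same u v)

  ≅-cong : ∀ {m} {K : Graph m} → H ≅ K → G ≅ K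
  ≅-cong (f , preserves) = f , λ u v → trans (same u v) (preserves u v)

isolated⇒unique : ∀ {n} (G : Graph n) → Connected G → ∀ w → (∀ x → adj G x w ≡ false) →
  ∀ u → u ≡ w
isolated⇒unique G conn w isolated u =
  reach-closed G (_≡ w) closed (proj₁ (conn w u)) w u refl (proj₂ (conn w u))
  where
  closed : ∀ {a b} → a ≡ w → Adj G a b → b ≡ w
  closed {b = b} refl w~b = ⊥-elim (true≢false (Adj-sym G w~b) (isolated b))

triangle : Bool → Bool → Bool → Fin 3 → Fin 3 → Bool
triangle a b c 0F 1F = a
triangle a b c 1F 0F = a
triangle a b c 0F 2F = b
triangle a b c 2F 0F = b
triangle a b c 1F 2F = c
triangle a b c 2F 1F = c
triangle a b c _  _  = false

Graph₃ : Bool → Bool → Bool → Graph 3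
Graph₃ a b c = record
  { adj    = triangle a b c
  ; sym    = symmetric
  ; irrefl = λ { 0F → refl ; 1F → refl ; 2F → refl }
  }
  where
  symmetric : ∀ u v → triangle a b c u v ≡ triangle a b c v u
  symmetric 0F 0F = refl
  symmetric 0F 1F = refl
  symmetric 0F 2F = refl
  symmetric 1F 0F = refl
  symmetric 1F 1F = refl
  symmetric 1F 2F = refl
  symmetric 2F 0F = refl
  symmetric 2F 1F = refl
  symmetric 2F 2F = refl

adj≡triangle : (G : Graph 3) → ∀ {a b c} →
  adj G 0F 1F ≡ a → adj G 0F 2F ≡ b → adj G 1F 2F ≡ c → ∀ u v → adj G u v ≡ adj (Graph₃ a b c) u v
adj≡triangle G e01 e02 e12 0F 0F = Graph.irrefl G 0F
adj≡triangle G e01 e02 e12 0F 1F = e01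
adj≡triangle G e01 e02 e12 0F 2F = e02
adj≡triangle G e01 e02 e12 1F 0F = trans (Graph.sym G 1F 0F) e01
adj≡triangle G e01 e02 e12 1F 1F = Graph.irrefl G 1F
adj≡triangle G e01 e02 e12 1F 2F = e12
adj≡triangle G e01 e02 e12 2F 0F = trans (Graph.sym G 2F 0F) e02
adj≡triangle G e01 e02 e12 2F 1F = trans (Graph.sym G 2F 1F) e12
adj≡triangle G e01 e02 e12 2F 2F = Graph.irrefl G 2F

Graph₃≅P₃ : ∀ a b c (π : Permutation′ 3) →
  {True (Fin.all? λ u → Fin.all? λ v → triangle a b c u v ≟ᵇ P3adj (π ⟨$⟩ʳ u) (π ⟨$⟩ʳ v))} →
  Graph₃ a b c ≅ P₃
Graph₃≅P₃ a b c π {preserves} = ↔⇒⤖ π , toWitness preserves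

Graph₃-two-edges : ∀ a b c → edgeCount (Graph₃ a b c) ≡ 2 →
  Graph₃ a b c ≅ P₃ × E₂ (Graph₃ a b c) ≡ W (Graph₃ a b c)
Graph₃-two-edges true  false true  _ = Graph₃≅P₃ _ _ _ Perm.id , refl
Graph₃-two-edges true  true  false _ = Graph₃≅P₃ _ _ _ (transpose 0F 1F) , refl
Graph₃-two-edges false true  true  _ = Graph₃≅P₃ _ _ _ (transpose 1F 2F) , refl
Graph₃-two-edges true  true  true  ()
Graph₃-two-edges true  false false ()
Graph₃-two-edges false true  false ()
Graph₃-two-edges false false true  ()
Graph₃-two-edges false false false ()

tree₃-two-edges : ∀ {G : Graph 3} a b c → (∀ u v → adj G u v ≡ adj (Graph₃ a b c) u v) →
  IsTree G → edgeCount (Graph₃ a b c) ≡ 2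
tree₃-two-edges true  false true  _ _ = refl
tree₃-two-edges true  true  false _ _ = refl
tree₃-two-edges false true  true  _ _ = refl
tree₃-two-edges {G} true true true same tree =
  ⊥-elim (<-irrefl (edgeCount-cong G (Graph₃ true true true) same) (edgeCount<n G tree 0F))
tree₃-two-edges {G} true false false same tree with () ←
  isolated⇒unique G (proj₁ tree) 2F (λ { 0F → same 0F 2F ; 1F → same 1F 2F ; 2F → same 2F 2F }) 0F
tree₃-two-edges {G} false false false same tree with () ←
  isolated⇒unique G (proj₁ tree) 2F (λ { 0F → same 0F 2F ; 1F → same 1F 2F ; 2F → same 2F 2F }) 0F
tree₃-two-edges {G} false true false same tree with () ←
  isolated⇒unique G (proj₁ tree) 1F (λ { 0F → same 0F 1F ; 1F → same 1F 1F ; 2F → same 2F 1F }) 0F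
tree₃-two-edges {G} false false true same tree with () ←
  isolated⇒unique G (proj₁ tree) 0F (λ { 0F → same 0F 0F ; 1F → same 1F 0F ; 2F → same 2F 0F }) 1F

module _ (G : Graph 3) where

  private
    a = adj G 0F 1F
    b = adj G 0F 2F
    c = adj G 1F 2F
    same : ∀ u v → adj G u v ≡ adj (Graph₃ a b c) u v
    same = adj≡triangle G refl refl refl

  two-edges⇒≅P₃ : edgeCount G ≡ 2 → G ≅ P₃
  two-edges⇒≅P₃ two = ≅-cong G (Graph₃ a b c) same {K = P₃}
    (proj₁ (Graph₃-two-edges a b c (trans (sym (edgeCount-cong G (Graph₃ a b c) same)) two)))

  tree⇒E₂≡W : IsTree G → E₂ G ≡ W G
  tree⇒E₂≡W tree = E₂≡W-cong G (Graph₃ a b c) same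
    (proj₂ (Graph₃-two-edges a b c (tree₃-two-edges a b c same tree)))

≅⇒≤ : ∀ {n m} (G : Graph n) (H : Graph m) → G ≅ H → n ≤ m
≅⇒≤ G H (f , _) = Fin.injective⇒≤ (Bijection.injective f)

theorem3p1 : (n : ℕ) → 3 ≤ n → (T : Graph n) → IsTree T →
    (2 * diam T ∸ 1) ^ 2 ≤ 4 * n ∸ 3 →
    (E₂ T ≤ W T) × ((E₂ T ≡ W T) ⇔ (T ≅ P₃))
theorem3p1 n 3≤n T tree diam-condition-holds =
  E₂≤W T 3≤n tree diam-small , mk⇔ equality⇒P₃ P₃⇒equality
  where
  diam-small : diam T * (diam T ∸ 1) ≤ n ∸ 1
  diam-small = diameter-condition n (diam T) (≤-trans (s≤s z≤n) 3≤n) diam-condition-holds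

  equality⇒P₃ : E₂ T ≡ W T → T ≅ P₃
  equality⇒P₃ E₂≡W with E₂≡W⇒n≡3×edgeCount≡2 T 3≤n tree diam-small E₂≡W
  ... | refl , two-edges = two-edges⇒≅P₃ T two-edges

  P₃⇒equality : T ≅ P₃ → E₂ T ≡ W T
  P₃⇒equality T≅P₃ with ≤-antisym (≅⇒≤ T P₃ T≅P₃) 3≤n
  ... | refl = tree⇒E₂≡W T tree
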